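{- Let $l\ge 1$ and let $d_1,\dots,d_l$ be nonnegative integers with $d=d_1+\cdots+d_l\ge 1$. For $1\le k\le d$ let $\left\lfloor{\mathbf{d}\atop k}\right\rfloor_O$ denote the number of $k$-tuples $$((\sigma_1,\dots,\sigma_{i_1}),(\sigma_{i_1+1},\dots,\sigma_{i_2}),\dots,(\sigma_{i_{k-1}+1},\dots,\sigma_d))$$ where $[\sigma_1,\dots,\sigma_d]$ is a permutation of the multiset $S(\mathbf{d})$ and $0<i_1<i_2<\cdots<i_{k-1}<d$. Then, as an identity of polynomials in $x$, $$\binom{d}{d_1,d_2,\dots,d_l}\binom{x+d}{d}=\sum_{k=1}^d\left\lfloor{\mathbf{d}\atop k}\right\rfloor_O\binom{x+1}{k}.$$
   Context: For $\mathbf{d}=(d_1,\dots,d_l)$, $S(\mathbf{d})$ is the multiset containing $j$ with multiplicity $d_j$ for each $j\in\{1,\dots,l\}$; a permutation of $S(\mathbf{d})$ is a word of length $d$ in which each $j$ appears exactly $d_j$ times. Thus $\left\lfloor{\mathbf{d}\atop k}\right\rfloor_O$ (the ordered Stirling number of the third kind, or ordered Lah number, over $S(\mathbf{d})$) counts ways to write a permutation of $S(\mathbf{d})$ and cut it into $k$ nonempty consecutive blocks. $\binom{d}{d_1,\dots,d_l}$ is the multinomial coefficient. -}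

module Defs where

open import Data.Nat using (ℕ; zero; suc; _+_; _*_; _∸_)
open import Data.Nat.Combinatorics using (_C_)
open import Data.Fin using (Fin)
open import Data.Fin.Properties using (_≟_)
open import Data.List using (List; []; _∷_; map; concatMap; length; filter; upTo; allFin; take; drop)
open import Data.Vec using (Vec; tabulate)
import Data.Vec.Properties as VecP
import Data.Nat.Properties as ℕP

total : ∀ {l} → Vec ℕ l → ℕ
total Vec.[] = 0
total (a Vec.∷ as) = a + total as

multinomial : ∀ {l} → Vec ℕ l → ℕ
multinomial Vec.[] = 1
multinomial (a Vec.∷ as) = ((a + total as) C a) * multinomial as

words : (l n : ℕ) → List (List (Fin l))
words l zero = [] ∷ []
words l (suc n) = concatMap (λ w → map (λ a → a ∷ w) (allFin l)) (words l n)

occ : ∀ {l} → Fin l → List (Fin l) → ℕ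
occ j w = length (filter (λ a → a ≟ j) w)

mult : ∀ {l} → List (Fin l) → Vec ℕ l
mult w = tabulate (λ j → occ j w)

perms : ∀ {l} → Vec ℕ l → List (List (Fin l))
perms {l} ds = filter (λ w → VecP.≡-dec ℕP._≟_ (mult w) ds) (words l (total ds))

-- cut sequences 0 < i₁ < ⋯ < i_{k-1} < n, encoded by the block lengths
-- (i₁, i₂ − i₁, …, n − i_{k-1}): lists of k positive naturals summing to n
cuts : ℕ → ℕ → List (List ℕ)
cuts zero zero = [] ∷ []
cuts (suc n) zero = []
cuts n (suc k) = concatMap (λ p → map (λ c → suc p ∷ c) (cuts (n ∸ suc p) k)) (upTo n)

cutWord : ∀ {A : Set} → List A → List ℕ → List (List A)
cutWord w [] = []
cutWord w (p ∷ ps) = take p w ∷ cutWord (drop p w) ps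

blockTuples : ∀ {l} → Vec ℕ l → ℕ → List (List (List (Fin l)))
blockTuples ds k = concatMap (λ w → map (cutWord w) (cuts (total ds) k)) (perms ds)

orderedLah : ∀ {l} → Vec ℕ l → ℕ → ℕ
orderedLah ds k = length (blockTuples ds k)

sumFrom1 : ℕ → (ℕ → ℕ) → ℕ
sumFrom1 zero f = 0
sumFrom1 (suc n) f = sumFrom1 n f + f (suc n)

module Submission where

--  * A k-tuple of blocks is a permutation of S(d) together with a cut
--    sequence, so  L(d,k) = |perms d| · |cuts d k|.
--  * Cut sequences of a length-d word into k blocks are compositions of d
--    into k positive parts; a hockey-stick sum shows there are C(d-1,k-1).
--  * Words with multiplicity vector v are counted by their first letter;
--    the multinomial coefficients satisfy the same recursion (a multinomial
--    Pascal rule), so |perms d| = M(d).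
--  * Finally  Σ_k C(d-1,k-1) C(x+1,k) = C(x+d,d)  is Vandermonde's identity.

open import Defs
open import Data.Nat using (ℕ; zero; suc; pred; _+_; _*_; _∸_; _≤_; s≤s; z≤n)
open import Data.Nat.Properties
  using (_≟_; +-commutativeSemigroup; +-identityʳ; +-suc; +-assoc; +-comm; *-zeroʳ; *-assoc;
         *-distribˡ-+; *-distribʳ-+; suc-injective; n<1+n; m+n≡0⇒m≡0; m+n≡0⇒n≡0; 0≢1+n)
open import Algebra.Properties.CommutativeSemigroup +-commutativeSemigroup
  using () renaming (interchange to +-interchange; x∙yz≈xz∙y to x+[y+z]≡x+z+y)
open import Data.Nat.Combinatorics
  using (_C_; nCn≡1; k>n⇒nCk≡0; nCk+nC[k+1]≡[n+1]C[k+1])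
open import Data.Fin using (Fin; zero; suc)
open import Data.Fin.Properties using () renaming (_≟_ to _≟ᶠ_)
open import Data.List using (List; []; _∷_; _++_; [_]; map; concatMap; filter; length; upTo; allFin)
open import Data.List.Properties using (length-++; length-map; map-upTo; upTo-∷ʳ; map-tabulate)
open import Data.Vec using (Vec; []; _∷_; lookup; updateAt)
import Data.Vec.Properties as Vec
open import Function using (_∘_)
open import Relation.Nullary using (Dec; yes; no; ¬_)
open import Data.Empty using (⊥-elim)
open import Relation.Binary.PropositionalEquality
  using (_≡_; refl; sym; trans; cong; cong₂; module ≡-Reasoning)
open ≡-Reasoning

∑ : {A : Set} → List A → (A → ℕ) → ℕ
∑ []       g = 0
∑ (x ∷ xs) g = g x + ∑ xs g

infix 5 ∑
syntax ∑ xs (λ x → e) = ∑[ x ← xs ] e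

∑-cong : {A : Set} (xs : List A) {f g : A → ℕ} → (∀ x → f x ≡ g x) → ∑ xs f ≡ ∑ xs g
∑-cong []       f≗g = refl
∑-cong (x ∷ xs) f≗g = cong₂ _+_ (f≗g x) (∑-cong xs f≗g)

∑-++ : {A : Set} (xs ys : List A) (g : A → ℕ) → ∑ (xs ++ ys) g ≡ ∑ xs g + ∑ ys g
∑-++ []       ys g = refl
∑-++ (x ∷ xs) ys g = trans (cong (g x +_) (∑-++ xs ys g)) (sym (+-assoc (g x) _ _))

∑-map : {A B : Set} (h : A → B) (xs : List A) (g : B → ℕ) → ∑ (map h xs) g ≡ ∑ xs (g ∘ h)
∑-map h []       g = refl
∑-map h (x ∷ xs) g = cong (g (h x) +_) (∑-map h xs g)

∑-concatMap : {A B : Set} (f : A → List B) (xs : List A) (g : B → ℕ) →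
  ∑ (concatMap f xs) g ≡ ∑[ x ← xs ] ∑ (f x) g
∑-concatMap f []       g = refl
∑-concatMap f (x ∷ xs) g =
  trans (∑-++ (f x) (concatMap f xs) g) (cong (∑ (f x) g +_) (∑-concatMap f xs g))

∑-+ : {A : Set} (xs : List A) (f g : A → ℕ) → ∑[ x ← xs ] (f x + g x) ≡ ∑ xs f + ∑ xs g
∑-+ []       f g = refl
∑-+ (x ∷ xs) f g =
  trans (cong (f x + g x +_) (∑-+ xs f g)) (+-interchange (f x) (g x) (∑ xs f) (∑ xs g))

∑-* : {A : Set} (xs : List A) (c : ℕ) (g : A → ℕ) → ∑[ x ← xs ] (c * g x) ≡ c * ∑ xs g
∑-* []       c g = sym (*-zeroʳ c)
∑-* (x ∷ xs) c g = trans (cong (c * g x +_) (∑-* xs c g)) (sym (*-distribˡ-+ c (g x) _))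

∑-zero : {A : Set} (xs : List A) → ∑[ x ← xs ] 0 ≡ 0
∑-zero []       = refl
∑-zero (x ∷ xs) = ∑-zero xs

∑-swap : {A B : Set} (xs : List A) (ys : List B) (h : A → B → ℕ) →
  ∑[ x ← xs ] ∑ ys (h x) ≡ ∑[ y ← ys ] ∑[ x ← xs ] h x y
∑-swap []       ys h = sym (∑-zero ys)
∑-swap (x ∷ xs) ys h =
  trans (cong (∑ ys (h x) +_) (∑-swap xs ys h)) (sym (∑-+ ys (h x) _))

∑-upTo-suc : (n : ℕ) (g : ℕ → ℕ) → ∑ (upTo (suc n)) g ≡ g 0 + (∑[ j ← upTo n ] g (suc j))
∑-upTo-suc n g = cong (g 0 +_) (trans (cong (λ js → ∑ js g) (sym (map-upTo suc n))) (∑-map suc (upTo n) g))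

∑-upTo-last : (n : ℕ) (g : ℕ → ℕ) → ∑ (upTo (suc n)) g ≡ ∑ (upTo n) g + g n
∑-upTo-last n g = begin
  ∑ (upTo (suc n)) g       ≡⟨ cong (λ js → ∑ js g) (sym (upTo-∷ʳ n)) ⟩
  ∑ (upTo n ++ [ n ]) g    ≡⟨ ∑-++ (upTo n) [ n ] g ⟩
  ∑ (upTo n) g + (g n + 0) ≡⟨ cong (∑ (upTo n) g +_) (+-identityʳ (g n)) ⟩
  ∑ (upTo n) g + g n       ∎

∑-allFin-suc : ∀ l (g : Fin (suc l) → ℕ) → ∑ (allFin (suc l)) g ≡ g zero + (∑[ j ← allFin l ] g (suc j))
∑-allFin-suc l g = cong (g zero +_) (trans (cong (λ as → ∑ as g) (sym (map-tabulate (λ j → j) suc))) (∑-map suc (allFin l) g))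

sumFrom1-upTo : (n : ℕ) (f : ℕ → ℕ) → sumFrom1 n f ≡ ∑[ j ← upTo n ] f (suc j)
sumFrom1-upTo zero    f = refl
sumFrom1-upTo (suc n) f =
  trans (cong (_+ f (suc n)) (sumFrom1-upTo n f)) (sym (∑-upTo-last n (f ∘ suc)))

𝟙 : {P : Set} → Dec P → ℕ
𝟙 (yes _) = 1
𝟙 (no _)  = 0

𝟙-no : {P : Set} → ¬ P → (p : Dec P) → 𝟙 p ≡ 0
𝟙-no ¬p (yes p) = ⊥-elim (¬p p)
𝟙-no ¬p (no _)  = refl

𝟙-yes : {P : Set} → P → (p : Dec P) → 𝟙 p ≡ 1
𝟙-yes p (yes _) = refl
𝟙-yes p (no ¬p) = ⊥-elim (¬p p)

𝟙-⇔ : {P Q : Set} → (P → Q) → (Q → P) → (p : Dec P) (q : Dec Q) → 𝟙 p ≡ 𝟙 q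
𝟙-⇔ to from (yes p) q = sym (𝟙-yes (to p) q)
𝟙-⇔ to from (no ¬p) q = sym (𝟙-no (¬p ∘ from) q)

length-filter : {A : Set} {P : A → Set} (P? : ∀ x → Dec (P x)) (xs : List A) →
  length (filter P? xs) ≡ ∑[ x ← xs ] 𝟙 (P? x)
length-filter P? []       = refl
length-filter P? (x ∷ xs) with P? x
... | yes _ = cong suc (length-filter P? xs)
... | no _  = length-filter P? xs

length-pairs : {A B C : Set} (g : A → B → C) (xs : List A) (ys : List B) →
  length (concatMap (λ x → map (g x) ys) xs) ≡ length xs * length ys
length-pairs g []       ys = refl
length-pairs g (x ∷ xs) ys =
  trans (length-++ (map (g x) ys)) (cong₂ _+_ (length-map (g x) ys) (length-pairs g xs ys))

-- compositions n k : the number of ways to write n as an ordered sum of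
-- k positive parts (the empty composition of 0 when k = 0).
compositions : ℕ → ℕ → ℕ
compositions zero    zero    = 1
compositions (suc n) zero    = 0
compositions zero    (suc k) = 0
compositions (suc n) (suc k) = n C k

compositions-pascal : ∀ n k → compositions n k + compositions n (suc k) ≡ n C k
compositions-pascal zero    zero    = refl
compositions-pascal zero    (suc k) = refl
compositions-pascal (suc n) zero    = refl
compositions-pascal (suc n) (suc k) = nCk+nC[k+1]≡[n+1]C[k+1] n k

-- Hockey stick: splitting off the first part p+1 of a composition of n.
compositions-first-part : ∀ n k → ∑[ p ← upTo n ] compositions (n ∸ suc p) k ≡ compositions n (suc k)
compositions-first-part zero    k = refl
compositions-first-part (suc n) k = begin
  ∑[ p ← upTo (suc n) ] compositions (suc n ∸ suc p) k
    ≡⟨ ∑-upTo-suc n (λ p → compositions (suc n ∸ suc p) k) ⟩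
  compositions n k + (∑[ p ← upTo n ] compositions (n ∸ suc p) k)
    ≡⟨ cong (compositions n k +_) (compositions-first-part n k) ⟩
  compositions n k + compositions n (suc k)
    ≡⟨ compositions-pascal n k ⟩
  compositions (suc n) (suc k) ∎

length-cuts-suc : ∀ n k → length (cuts n (suc k)) ≡ ∑[ p ← upTo n ] length (cuts (n ∸ suc p) k)
length-cuts-suc n k = begin
  length (cuts n (suc k))
    ≡⟨ cong length (unfold n) ⟩
  length (concatMap blocksWithFirst (upTo n))
    ≡⟨ length-concatMap (upTo n) ⟩
  ∑[ p ← upTo n ] length (blocksWithFirst p)
    ≡⟨ ∑-cong (upTo n) (λ p → length-map (suc p ∷_) (cuts (n ∸ suc p) k)) ⟩
  ∑[ p ← upTo n ] length (cuts (n ∸ suc p) k) ∎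
  where
  blocksWithFirst : ℕ → List (List ℕ)
  blocksWithFirst p = map (suc p ∷_) (cuts (n ∸ suc p) k)

  unfold : ∀ n → cuts n (suc k) ≡ concatMap (λ p → map (suc p ∷_) (cuts (n ∸ suc p) k)) (upTo n)
  unfold zero    = refl
  unfold (suc n) = refl

  length-concatMap : {B : Set} (xs : List ℕ) {f : ℕ → List B} →
    length (concatMap f xs) ≡ ∑[ x ← xs ] length (f x)
  length-concatMap []           = refl
  length-concatMap (x ∷ xs) {f} = trans (length-++ (f x)) (cong (length (f x) +_) (length-concatMap xs))

length-cuts : ∀ n k → length (cuts n k) ≡ compositions n k
length-cuts zero    zero    = refl
length-cuts (suc n) zero    = refl
length-cuts n       (suc k) = begin
  length (cuts n (suc k))                              ≡⟨ length-cuts-suc n k ⟩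
  ∑[ p ← upTo n ] length (cuts (n ∸ suc p) k)          ≡⟨ ∑-cong (upTo n) (λ p → length-cuts (n ∸ suc p) k) ⟩
  ∑[ p ← upTo n ] compositions (n ∸ suc p) k           ≡⟨ compositions-first-part n k ⟩
  compositions n (suc k)                               ∎

vandermonde : ∀ n x r → ∑[ j ← upTo (suc n) ] (n C j) * (x C (r + j)) ≡ (n + x) C (n + r)
vandermonde zero    x r = trans (+-identityʳ _) (trans (+-identityʳ _) (cong (x C_) (+-identityʳ r)))
vandermonde (suc n) x r = begin
  ∑[ j ← upTo (suc (suc n)) ] (suc n C j) * (x C (r + j))
    ≡⟨ ∑-upTo-suc (suc n) (λ j → (suc n C j) * (x C (r + j))) ⟩
  x C (r + 0) + 0 + (∑[ j ← upTo (suc n) ] (suc n C suc j) * (x C (r + suc j)))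
    ≡⟨ cong (x C (r + 0) + 0 +_) (trans (∑-cong (upTo (suc n)) pascal) (∑-+ (upTo (suc n)) low high)) ⟩
  x C (r + 0) + 0 + (∑ (upTo (suc n)) low + ∑ (upTo (suc n)) high)
    ≡⟨ x+[y+z]≡x+z+y (x C (r + 0) + 0) (∑ (upTo (suc n)) low) (∑ (upTo (suc n)) high) ⟩
  (x C (r + 0) + 0 + ∑ (upTo (suc n)) high) + ∑ (upTo (suc n)) low
    ≡⟨ cong₂ _+_ shiftedDown shiftedUp ⟩
  (n + x) C (n + r) + (n + x) C suc (n + r)
    ≡⟨ nCk+nC[k+1]≡[n+1]C[k+1] (n + x) (n + r) ⟩
  (suc n + x) C (suc n + r) ∎
  where
  low high : ℕ → ℕ
  low  j = (n C j) * (x C (r + suc j))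
  high j = (n C suc j) * (x C (r + suc j))

  pascal : ∀ j → (suc n C suc j) * (x C (r + suc j)) ≡ low j + high j
  pascal j = trans (cong (_* (x C (r + suc j))) (sym (nCk+nC[k+1]≡[n+1]C[k+1] n j)))
                   (*-distribʳ-+ (x C (r + suc j)) (n C j) (n C suc j))

  -- the high terms reassemble the sum for n, r (its last term C(n,n+1) vanishes)
  shiftedDown : x C (r + 0) + 0 + ∑ (upTo (suc n)) high ≡ (n + x) C (n + r)
  shiftedDown = begin
    x C (r + 0) + 0 + ∑ (upTo (suc n)) high
      ≡⟨ cong (x C (r + 0) + 0 +_) (∑-upTo-last n high) ⟩
    x C (r + 0) + 0 + (∑ (upTo n) high + (n C suc n) * (x C (r + suc n)))
      ≡⟨ cong (λ c → x C (r + 0) + 0 + (∑ (upTo n) high + c * (x C (r + suc n)))) (k>n⇒nCk≡0 (n<1+n n)) ⟩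
    x C (r + 0) + 0 + (∑ (upTo n) high + 0)
      ≡⟨ cong (x C (r + 0) + 0 +_) (+-identityʳ _) ⟩
    x C (r + 0) + 0 + ∑ (upTo n) high
      ≡⟨ sym (∑-upTo-suc n (λ j → (n C j) * (x C (r + j)))) ⟩
    ∑[ j ← upTo (suc n) ] (n C j) * (x C (r + j))
      ≡⟨ vandermonde n x r ⟩
    (n + x) C (n + r) ∎

  shiftedUp : ∑ (upTo (suc n)) low ≡ (n + x) C suc (n + r)
  shiftedUp = begin
    ∑ (upTo (suc n)) low
      ≡⟨ ∑-cong (upTo (suc n)) (λ j → cong (λ i → (n C j) * (x C i)) (+-suc r j)) ⟩
    ∑[ j ← upTo (suc n) ] (n C j) * (x C (suc r + j))
      ≡⟨ vandermonde n x (suc r) ⟩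
    (n + x) C (n + suc r)
      ≡⟨ cong ((n + x) C_) (+-suc n r) ⟩
    (n + x) C suc (n + r) ∎

compositions-binomial : ∀ {d} → 1 ≤ d → ∀ x →
  ∑[ j ← upTo d ] compositions d (suc j) * ((x + 1) C suc j) ≡ (x + d) C d
compositions-binomial {suc n} (s≤s z≤n) x = begin
  ∑[ j ← upTo (suc n) ] (n C j) * ((x + 1) C (1 + j))  ≡⟨ vandermonde n (x + 1) 1 ⟩
  (n + (x + 1)) C (n + 1)                               ≡⟨ cong₂ _C_ (+-comm n (x + 1)) (+-comm n 1) ⟩
  (x + 1 + n) C suc n                                   ≡⟨ cong (_C suc n) (+-assoc x 1 n) ⟩
  (x + suc n) C suc n                                   ∎

ifPos : ℕ → ℕ → ℕ
ifPos zero    m = 0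
ifPos (suc _) m = m

remove : ∀ {l} → Fin l → Vec ℕ l → Vec ℕ l
remove a v = updateAt v a pred

total-remove : ∀ {l} (a : Fin l) (v : Vec ℕ l) {k} →
  lookup v a ≡ suc k → total v ≡ suc (total (remove a v))
total-remove zero    (suc x ∷ v) refl = refl
total-remove (suc a) (x ∷ v)     eq   = trans (cong (x +_) (total-remove a v eq)) (+-suc x _)

total≡0⇒mult[] : ∀ {l} (v : Vec ℕ l) → total v ≡ 0 → mult [] ≡ v
total≡0⇒mult[] []      _  = refl
total≡0⇒mult[] (x ∷ v) t≡0 = cong₂ _∷_ (sym (m+n≡0⇒m≡0 x t≡0)) (total≡0⇒mult[] v (m+n≡0⇒n≡0 x t≡0))

multinomial-empty : ∀ {l} (v : Vec ℕ l) → total v ≡ 0 → multinomial v ≡ 1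
multinomial-empty []      _   = refl
multinomial-empty (x ∷ v) t≡0 rewrite m+n≡0⇒m≡0 x t≡0 =
  trans (+-identityʳ _) (multinomial-empty v (m+n≡0⇒n≡0 x t≡0))

mult-∷ : ∀ {l} (a : Fin l) (w : List (Fin l)) → mult (a ∷ w) ≡ updateAt (mult w) a suc
mult-∷ a w = trans (Vec.tabulate-cong occ-∷) (Vec.tabulate∘lookup _)
  where
  occ-∷ : ∀ j → occ j (a ∷ w) ≡ lookup (updateAt (mult w) a suc) j
  occ-∷ j with a ≟ᶠ j
  ... | yes refl = sym (trans (Vec.lookup∘updateAt a (mult w)) (cong suc (Vec.lookup∘tabulate _ a)))
  ... | no a≢j   = sym (trans (Vec.lookup∘updateAt′ j a (a≢j ∘ sym) (mult w)) (Vec.lookup∘tabulate _ j))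

remove-add : ∀ {l} (a : Fin l) (u : Vec ℕ l) → remove a (updateAt u a suc) ≡ u
remove-add a u = trans (Vec.updateAt-updateAt a u) (Vec.updateAt-id-local a u refl)

add-remove : ∀ {l} (a : Fin l) (v : Vec ℕ l) {k} → lookup v a ≡ suc k → updateAt (remove a v) a suc ≡ v
add-remove a v va≡1+k =
  trans (Vec.updateAt-updateAt a v) (Vec.updateAt-id-local a v (trans (cong (λ (n : ℕ) → suc (pred n)) va≡1+k) (sym va≡1+k)))

lookup-mult-∷ : ∀ {l} (a : Fin l) (w : List (Fin l)) → lookup (mult (a ∷ w)) a ≡ suc (lookup (mult w) a)
lookup-mult-∷ a w = trans (cong (λ u → lookup u a) (mult-∷ a w)) (Vec.lookup∘updateAt a (mult w))

_≟ᵥ_ : ∀ {l} (u v : Vec ℕ l) → Dec (u ≡ v)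
_≟ᵥ_ = Vec.≡-dec _≟_

𝟙-mult-∷ : ∀ {l} (a : Fin l) (w : List (Fin l)) (v : Vec ℕ l) →
  𝟙 (mult (a ∷ w) ≟ᵥ v) ≡ ifPos (lookup v a) (𝟙 (mult w ≟ᵥ remove a v))
𝟙-mult-∷ a w v with lookup v a in va
... | zero  = 𝟙-no a∉v (mult (a ∷ w) ≟ᵥ v)
  where
  a∉v : ¬ (mult (a ∷ w) ≡ v)
  a∉v refl = 0≢1+n (trans (sym va) (lookup-mult-∷ a w))
... | suc k = 𝟙-⇔ to from (mult (a ∷ w) ≟ᵥ v) (mult w ≟ᵥ remove a v)
  where
  to : mult (a ∷ w) ≡ v → mult w ≡ remove a v
  to a∷w↦v = begin
    mult w                             ≡⟨ sym (remove-add a (mult w)) ⟩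
    remove a (updateAt (mult w) a suc) ≡⟨ cong (remove a) (sym (mult-∷ a w)) ⟩
    remove a (mult (a ∷ w))            ≡⟨ cong (remove a) a∷w↦v ⟩
    remove a v                         ∎
  from : mult w ≡ remove a v → mult (a ∷ w) ≡ v
  from w↦v-a = trans (mult-∷ a w) (trans (cong (λ u → updateAt u a suc) w↦v-a) (add-remove a v va))

count : (l n : ℕ) → Vec ℕ l → ℕ
count l n v = ∑[ w ← words l n ] 𝟙 (mult w ≟ᵥ v)

∑-ifPos : {A : Set} (c : ℕ) (xs : List A) (g : A → ℕ) → ∑[ x ← xs ] ifPos c (g x) ≡ ifPos c (∑ xs g)
∑-ifPos zero    xs g = ∑-zero xs
∑-ifPos (suc c) xs g = refl

-- Classifying the words of length n+1 by their first letter.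
count-suc : ∀ l n (v : Vec ℕ l) →
  count l (suc n) v ≡ ∑[ a ← allFin l ] ifPos (lookup v a) (count l n (remove a v))
count-suc l n v = begin
  count l (suc n) v
    ≡⟨ ∑-concatMap (λ w → map (λ a → a ∷ w) (allFin l)) (words l n) (λ u → 𝟙 (mult u ≟ᵥ v)) ⟩
  ∑[ w ← words l n ] ∑ (map (λ a → a ∷ w) (allFin l)) (λ u → 𝟙 (mult u ≟ᵥ v))
    ≡⟨ ∑-cong (words l n) (λ w → ∑-map (λ a → a ∷ w) (allFin l) (λ u → 𝟙 (mult u ≟ᵥ v))) ⟩
  ∑[ w ← words l n ] ∑[ a ← allFin l ] 𝟙 (mult (a ∷ w) ≟ᵥ v)
    ≡⟨ ∑-swap (words l n) (allFin l) (λ w a → 𝟙 (mult (a ∷ w) ≟ᵥ v)) ⟩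
  ∑[ a ← allFin l ] ∑[ w ← words l n ] 𝟙 (mult (a ∷ w) ≟ᵥ v)
    ≡⟨ ∑-cong (allFin l) (λ a → ∑-cong (words l n) (λ w → 𝟙-mult-∷ a w v)) ⟩
  ∑[ a ← allFin l ] ∑[ w ← words l n ] ifPos (lookup v a) (𝟙 (mult w ≟ᵥ remove a v))
    ≡⟨ ∑-cong (allFin l) (λ a → ∑-ifPos (lookup v a) (words l n) (λ w → 𝟙 (mult w ≟ᵥ remove a v))) ⟩
  ∑[ a ← allFin l ] ifPos (lookup v a) (count l n (remove a v)) ∎

ifPos-* : ∀ c a m → ifPos c (a * m) ≡ ifPos c a * m
ifPos-* zero    a m = refl
ifPos-* (suc c) a m = refl

*-ifPos : ∀ c a m → a * ifPos c m ≡ ifPos c a * m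
*-ifPos zero    a m = *-zeroʳ a
*-ifPos (suc c) a m = refl

pascal-ifPos : ∀ x t → ifPos x ((pred x + t) C pred x) + ifPos t ((x + pred t) C x) ≡ ifPos (x + t) ((x + t) C x)
pascal-ifPos zero    zero    = refl
pascal-ifPos zero    (suc t) = refl
pascal-ifPos (suc y) zero    rewrite +-identityʳ y = trans (+-identityʳ _) (trans (nCn≡1 y) (sym (nCn≡1 (suc y))))
pascal-ifPos (suc y) (suc t) rewrite +-suc y t = nCk+nC[k+1]≡[n+1]C[k+1] (suc (y + t)) y

multinomial-pascal : ∀ {l} (v : Vec ℕ l) →
  ∑[ a ← allFin l ] ifPos (lookup v a) (multinomial (remove a v)) ≡ ifPos (total v) (multinomial v)
multinomial-pascal []                = refl
multinomial-pascal {suc l} (x ∷ xs) = begin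
  ∑ (allFin (suc l)) term
    ≡⟨ ∑-allFin-suc l term ⟩
  ifPos x (c₁ * m) + (∑[ j ← allFin l ] term (suc j))
    ≡⟨ cong (ifPos x (c₁ * m) +_) otherLetters ⟩
  ifPos x (c₁ * m) + c₂ * ifPos t m
    ≡⟨ cong₂ _+_ (ifPos-* x c₁ m) (*-ifPos t c₂ m) ⟩
  ifPos x c₁ * m + ifPos t c₂ * m
    ≡⟨ sym (*-distribʳ-+ m (ifPos x c₁) (ifPos t c₂)) ⟩
  (ifPos x c₁ + ifPos t c₂) * m
    ≡⟨ cong (_* m) (pascal-ifPos x t) ⟩
  ifPos (x + t) ((x + t) C x) * m
    ≡⟨ sym (ifPos-* (x + t) ((x + t) C x) m) ⟩
  ifPos (x + t) (multinomial (x ∷ xs)) ∎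
  where
  t m c₁ c₂ : ℕ
  t  = total xs
  m  = multinomial xs
  c₁ = (pred x + t) C pred x
  c₂ = (x + pred t) C x

  term : Fin (suc l) → ℕ
  term a = ifPos (lookup (x ∷ xs) a) (multinomial (remove a (x ∷ xs)))

  -- removing a later letter j leaves |xs| − 1 later letters, so the first factor is C(x + |xs| − 1, x)
  otherLetter : ∀ j → term (suc j) ≡ c₂ * ifPos (lookup xs j) (multinomial (remove j xs))
  otherLetter j with lookup xs j in xsj
  ... | zero  = sym (*-zeroʳ c₂)
  ... | suc k = cong (λ s → ((x + s) C x) * multinomial (remove j xs)) (cong pred (sym (total-remove j xs xsj)))

  otherLetters : ∑[ j ← allFin l ] term (suc j) ≡ c₂ * ifPos t m
  otherLetters = begin
    ∑[ j ← allFin l ] term (suc j)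
      ≡⟨ ∑-cong (allFin l) otherLetter ⟩
    ∑[ j ← allFin l ] c₂ * ifPos (lookup xs j) (multinomial (remove j xs))
      ≡⟨ ∑-* (allFin l) c₂ _ ⟩
    c₂ * (∑[ j ← allFin l ] ifPos (lookup xs j) (multinomial (remove j xs)))
      ≡⟨ cong (c₂ *_) (multinomial-pascal xs) ⟩
    c₂ * ifPos t m ∎

count≡multinomial : ∀ {l} n (v : Vec ℕ l) → total v ≡ n → count l n v ≡ multinomial v
count≡multinomial {l} zero v t≡0 = begin
  𝟙 (mult [] ≟ᵥ v) + 0 ≡⟨ +-identityʳ _ ⟩
  𝟙 (mult [] ≟ᵥ v)     ≡⟨ 𝟙-yes (total≡0⇒mult[] v t≡0) (mult [] ≟ᵥ v) ⟩
  1                    ≡⟨ sym (multinomial-empty v t≡0) ⟩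
  multinomial v        ∎
count≡multinomial {l} (suc n) v t≡1+n = begin
  count l (suc n) v
    ≡⟨ count-suc l n v ⟩
  ∑[ a ← allFin l ] ifPos (lookup v a) (count l n (remove a v))
    ≡⟨ ∑-cong (allFin l) firstLetter ⟩
  ∑[ a ← allFin l ] ifPos (lookup v a) (multinomial (remove a v))
    ≡⟨ multinomial-pascal v ⟩
  ifPos (total v) (multinomial v)
    ≡⟨ cong (λ s → ifPos s (multinomial v)) t≡1+n ⟩
  multinomial v ∎
  where
  firstLetter : ∀ a → ifPos (lookup v a) (count l n (remove a v)) ≡ ifPos (lookup v a) (multinomial (remove a v))
  firstLetter a with lookup v a in va
  ... | zero  = refl
  ... | suc k = count≡multinomial n (remove a v) (suc-injective (trans (sym (total-remove a v va)) t≡1+n))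

length-perms : ∀ {l} (ds : Vec ℕ l) → length (perms ds) ≡ multinomial ds
length-perms {l} ds =
  trans (length-filter (λ w → mult w ≟ᵥ ds) (words l (total ds))) (count≡multinomial (total ds) ds refl)

-- A block tuple is a permutation together with a composition of d into k parts.
orderedLah-product : ∀ {l} (ds : Vec ℕ l) k → orderedLah ds k ≡ multinomial ds * compositions (total ds) k
orderedLah-product ds k =
  trans (length-pairs cutWord (perms ds) (cuts (total ds) k))
        (cong₂ _*_ (length-perms ds) (length-cuts (total ds) k))

theorem7 : (l : ℕ) → 1 ≤ l → (ds : Vec ℕ l) → 1 ≤ total ds → (x : ℕ) →
    multinomial ds * ((x + total ds) C total ds)
      ≡ sumFrom1 (total ds) (λ k → orderedLah ds k * ((x + 1) C k))
theorem7 l _ ds 1≤d x = sym (begin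
  sumFrom1 d (λ k → orderedLah ds k * ((x + 1) C k))
    ≡⟨ sumFrom1-upTo d (λ k → orderedLah ds k * ((x + 1) C k)) ⟩
  ∑[ j ← upTo d ] orderedLah ds (suc j) * ((x + 1) C suc j)
    ≡⟨ ∑-cong (upTo d) factor ⟩
  ∑[ j ← upTo d ] M * (compositions d (suc j) * ((x + 1) C suc j))
    ≡⟨ ∑-* (upTo d) M _ ⟩
  M * (∑[ j ← upTo d ] compositions d (suc j) * ((x + 1) C suc j))
    ≡⟨ cong (M *_) (compositions-binomial 1≤d x) ⟩
  M * ((x + d) C d) ∎)
  where
  d M : ℕ
  d = total ds
  M = multinomial ds

  factor : ∀ j → orderedLah ds (suc j) * ((x + 1) C suc j) ≡ M * (compositions d (suc j) * ((x + 1) C suc j))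
  factor j = trans (cong (_* ((x + 1) C suc j)) (orderedLah-product ds (suc j)))
                   (*-assoc M (compositions d (suc j)) ((x + 1) C suc j))
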